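{- Let $\Sigma = S_1 \ast \dots \ast S_n$ be a spatial conjunction. Then $\Sigma$ is satisfiable (i.e. there exist a stack $s$ and a heap $h$ with $s,h \models \Sigma$) if, and only if, the pure formula $\mathrm{WellFormed}(\Sigma)$ is satisfiable (i.e. there exists a stack $s$ with $s(\mathrm{WellFormed}(\Sigma)) = \top$).
   Context: Setting: a many-sorted first-order language whose sorts include $\mathsf{Int}$ (integers) and $\mathsf{Bool}$, with built-in equality $\simeq$, the boolean connectives and quantifiers, and possibly further theory symbols (e.g. arithmetic) with their standard interpretations. Variables are uninterpreted constant symbols. A formula or expression is pure if it contains no spatial symbol. A stack is a function $s$ mapping each variable to a value of its sort; it is extended to all pure expressions by the standard interpretation of theory symbols. A heap is a partial function $h\colon \mathbb{Z} \rightharpoonup \mathsf{Val}$ (where $\mathsf{Val}$ is the disjoint union of the value sets of all sorts). For heaps $h_1,\dots,h_n$, writing $h = h_1 \ast \dots \ast h_n$ means $h$ is their union and their domains are pairwise disjoint. Spatial predicates are $\mathrm{emp}$, $\mathrm{next}(x,y)$ and $\mathrm{lseg}(x,y)$ with $x,y$ pure expressions of sort $\mathsf{Int}$. A spatial conjunction $\Sigma = S_1 \ast \dots \ast S_n$ ($n \ge 0$) of spatial predicates is treated as a finite multiset of spatial predicates. Semantics: $s,h \models \Pi$ for pure $\Pi$ iff $s(\Pi)=\top$; $s,h\models \mathrm{emp}$ iff $h=\emptyset$; $s,h \models \mathrm{next}(x,y)$ iff $h = \{s(x)\mapsto s(y)\}$; $s,h \models F_1 \ast F_2$ iff $h = h_1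 \ast h_2$ for some $h_1,h_2$ with $s,h_1\models F_1$ and $s,h_2\models F_2$ (the empty spatial conjunction means $\mathrm{emp}$); $\mathrm{lseg}$ is given by the inductive definition $\mathrm{lseg}(x,z) \equiv (x\simeq z \land \mathrm{emp}) \lor (x \not\simeq z \land \exists y.\, \mathrm{next}(x,y)\ast \mathrm{lseg}(y,z))$, i.e. $s,h\models\mathrm{lseg}(x,z)$ iff there are $n\ge 0$ and integers $a_0,\dots,a_n$ with $a_0=s(x)$, $a_n = s(z)$, $a_i \neq s(z)$ for $i<n$, and $h = \{a_0\mapsto a_1\} \ast \{a_1\mapsto a_2\}\ast\dots\ast\{a_{n-1}\mapsto a_n\}$. Boolean connectives are interpreted classically. Definitions: for a spatial predicate $S$, $\mathrm{Empty}(\mathrm{emp}) = \top$, $\mathrm{Empty}(\mathrm{next}(x,y)) = \bot$, $\mathrm{Empty}(\mathrm{lseg}(x,y)) = (x\simeq y)$; $\mathrm{Addr}(\mathrm{next}(x,y)) = \mathrm{Addr}(\mathrm{lseg}(x,y)) = x$ ($\mathrm{emp}$ has no address). $\mathrm{Collide}(S,S') = \lnot\mathrm{Empty}(S)\land\lnot\mathrm{Empty}(S')\land \mathrm{Addr}(S)\simeq\mathrm{Addr}(S')$ (which is $\bot$ if $S$ or $S'$ is $\mathrm{emp}$). For $\Sigma = S_1\ast\dots\ast S_n$, $\mathrm{WellFormed}(\Sigma) = \bigwedge_{1\le i<j\le n} \lnot\mathrm{Collide}(S_i,S_j)$. -}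

module Defs where

open import Data.Nat using (ℕ) renaming (_≟_ to _≟ℕ_)
open import Data.Integer using (ℤ) renaming (_+_ to _+ℤ_; _*_ to _*ℤ_; -_ to -ℤ_)
open import Data.Bool using (Bool; true; false; if_then_else_)
open import Data.Maybe using (Maybe; just; nothing)
open import Data.List using (List; []; _∷_)
open import Data.Product using (Σ; _×_; _,_; ∃; ∃-syntax)
open import Data.Sum using (_⊎_)
open import Data.Unit using (⊤)
open import Data.Empty using (⊥)
open import Relation.Nullary using (¬_; yes; no)
open import Relation.Binary.PropositionalEquality using (_≡_; _≢_)

data Sort : Set where
  IntS BoolS : Sort

Val : Sort → Set
Val IntS  = ℤ
Val BoolS = Bool

Var : Sort → Set
Var _ = ℕ

Stack : Set
Stack = (σ : Sort) → Var σ → Val σ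

update : Stack → (σ : Sort) → Var σ → Val σ → Stack
update s IntS  x v IntS  y with x ≟ℕ y
... | yes _ = v
... | no  _ = s IntS y
update s IntS  x v BoolS y = s BoolS y
update s BoolS x v IntS  y = s IntS y
update s BoolS x v BoolS y with x ≟ℕ y
... | yes _ = v
... | no  _ = s BoolS y

data Term : Sort → Set where
  var   : ∀ {σ} → Var σ → Term σ
  lit   : ℤ → Term IntS
  _⊕_   : Term IntS → Term IntS → Term IntS
  _⊗_   : Term IntS → Term IntS → Term IntS
  ⊖_    : Term IntS → Term IntS
  blit  : Bool → Term BoolS
  ite   : ∀ {σ} → Term BoolS → Term σ → Term σ → Term σ

eval : ∀ {σ} → Stack → Term σ → Val σ
eval s (var {σ} x) = s σ x
eval s (lit n)     = n
eval s (t ⊕ u)     = eval s t +ℤ eval s u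
eval s (t ⊗ u)     = eval s t *ℤ eval s u
eval s (⊖ t)       = -ℤ eval s t
eval s (blit b)    = b
eval s (ite c t u) = if eval s c then eval s t else eval s u

data Formula : Set where
  ⊤f ⊥f   : Formula
  _≃_     : ∀ {σ} → Term σ → Term σ → Formula
  atom    : Term BoolS → Formula
  ¬f_     : Formula → Formula
  _∧f_    : Formula → Formula → Formula
  _∨f_    : Formula → Formula → Formula
  ∀f ∃f   : (σ : Sort) → Var σ → Formula → Formula

⟦_⟧ : Formula → Stack → Set
⟦ ⊤f ⟧ s      = ⊤
⟦ ⊥f ⟧ s      = ⊥
⟦ t ≃ u ⟧ s   = eval s t ≡ eval s u
⟦ atom b ⟧ s  = eval s b ≡ true
⟦ ¬f φ ⟧ s    = ¬ ⟦ φ ⟧ s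
⟦ φ ∧f ψ ⟧ s  = ⟦ φ ⟧ s × ⟦ ψ ⟧ s
⟦ φ ∨f ψ ⟧ s  = ⟦ φ ⟧ s ⊎ ⟦ ψ ⟧ s
⟦ ∀f σ x φ ⟧ s = (v : Val σ) → ⟦ φ ⟧ (update s σ x v)
⟦ ∃f σ x φ ⟧ s = Σ (Val σ) λ v → ⟦ φ ⟧ (update s σ x v)

AnyVal : Set
AnyVal = Σ Sort Val

Heap : Set
Heap = ℤ → Maybe AnyVal

-- h = h₁ ∗ h₂ : h is the union of h₁, h₂ and their domains are disjoint
_≔_∗_ : Heap → Heap → Heap → Set
h ≔ h₁ ∗ h₂ = ∀ a → (h₁ a ≡ nothing × h a ≡ h₂ a) ⊎ (h₂ a ≡ nothing × h a ≡ h₁ a)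

IsEmpty : Heap → Set
IsEmpty h = ∀ a → h a ≡ nothing

PointsTo : Heap → ℤ → ℤ → Set
PointsTo h a b = ∀ c → (c ≡ a → h c ≡ just (IntS , b)) × (c ≢ a → h c ≡ nothing)

data LsegSem : Heap → ℤ → ℤ → Set where
  lseg-nil  : ∀ {h x z} → x ≡ z → IsEmpty h → LsegSem h x z
  lseg-cons : ∀ {h x z} (y : ℤ) (h₁ h₂ : Heap) → x ≢ z →
              h ≔ h₁ ∗ h₂ → PointsTo h₁ x y → LsegSem h₂ y z → LsegSem h x z

data Spatial : Set where
  emp  : Spatial
  next : Term IntS → Term IntS → Spatial
  lseg : Term IntS → Term IntS → Spatial

-- a spatial conjunction S₁ ∗ … ∗ Sₙ (a finite multiset, represented by a list)
SpatialConj : Set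
SpatialConj = List Spatial

_,_⊨ₛ_ : Stack → Heap → Spatial → Set
s , h ⊨ₛ emp      = IsEmpty h
s , h ⊨ₛ next x y = PointsTo h (eval s x) (eval s y)
s , h ⊨ₛ lseg x y = LsegSem h (eval s x) (eval s y)

_,_⊨_ : Stack → Heap → SpatialConj → Set
s , h ⊨ []      = IsEmpty h
s , h ⊨ (S ∷ Σ') = ∃[ h₁ ] ∃[ h₂ ] (h ≔ h₁ ∗ h₂ × (s , h₁ ⊨ₛ S) × (s , h₂ ⊨ Σ'))

Empty : Spatial → Formula
Empty emp        = ⊤f
Empty (next x y) = ⊥f
Empty (lseg x y) = x ≃ y

Addr : Spatial → Maybe (Term IntS)
Addr emp        = nothing
Addr (next x y) = just x
Addr (lseg x y) = just x

Collide : Spatial → Spatial → Formula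
Collide S S' with Addr S | Addr S'
... | just a | just a' = (¬f Empty S) ∧f ((¬f Empty S') ∧f (a ≃ a'))
... | _      | _       = ⊥f

NoCollideWith : Spatial → SpatialConj → Formula
NoCollideWith S []        = ⊤f
NoCollideWith S (S' ∷ Σ') = (¬f Collide S S') ∧f NoCollideWith S Σ'

WellFormed : SpatialConj → Formula
WellFormed []       = ⊤f
WellFormed (S ∷ Σ') = NoCollideWith S Σ' ∧f WellFormed Σ'

Satisfiable : SpatialConj → Set
Satisfiable Σ' = ∃[ s ] ∃[ h ] (s , h ⊨ Σ')

PureSatisfiable : Formula → Set
PureSatisfiable φ = ∃[ s ] ⟦ φ ⟧ s

module Submission where

open import Defs
open import Data.Empty using (⊥; ⊥-elim)
open import Data.Integer using (ℤ; _≟_)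
open import Data.List using ([]; _∷_)
open import Data.List.Relation.Unary.Any using (Any; here; there)
open import Data.Maybe using (just; nothing; _<∣>_)
open import Data.Maybe.Properties using (<∣>-identityʳ)
open import Data.Product using (_×_; _,_; proj₁; ∃-syntax)
open import Data.Sum using (_⊎_; inj₁; inj₂)
open import Data.Unit using (tt)
open import Relation.Nullary using (¬_; yes; no)
open import Relation.Binary.PropositionalEquality using (_≡_; _≢_; refl; sym; trans)

-- Under a stack s, a spatial predicate S forces a set of allocated addresses:
-- {x} for next(x, y), {x} for lseg(x, y) when x ≠ y, and nothing otherwise.
-- Two predicates collide exactly when these sets meet.  Every model of S
-- allocates them, so in a model of Σ the sets of distinct conjuncts are
-- separated, which is WellFormed(Σ).  Conversely each S has a model whose
-- domain is exactly its forced set (take lseg of length at most one), and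
-- when Σ is well formed these minimal heaps are pairwise disjoint, so their
-- union is a model of Σ.

_∈dom_ : ℤ → Heap → Set
a ∈dom h = h a ≢ nothing

≡just⇒≢nothing : ∀ {v : AnyVal} {m} → m ≡ just v → m ≢ nothing
≡just⇒≢nothing m≡just m≡nothing with trans (sym m≡just) m≡nothing
... | ()

∈dom-∗ˡ : ∀ {h h₁ h₂ a} → h ≔ h₁ ∗ h₂ → a ∈dom h₁ → a ∈dom h
∈dom-∗ˡ {a = a} sep a∈h₁ with sep a
... | inj₁ (h₁a≡nothing , _) = ⊥-elim (a∈h₁ h₁a≡nothing)
... | inj₂ (_ , ha≡h₁a)      = λ ha≡nothing → a∈h₁ (trans (sym ha≡h₁a) ha≡nothing)

∈dom-∗ʳ : ∀ {h h₁ h₂ a} → h ≔ h₁ ∗ h₂ → a ∈dom h₂ → a ∈dom h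
∈dom-∗ʳ {a = a} sep a∈h₂ with sep a
... | inj₁ (_ , ha≡h₂a)      = λ ha≡nothing → a∈h₂ (trans (sym ha≡h₂a) ha≡nothing)
... | inj₂ (h₂a≡nothing , _) = ⊥-elim (a∈h₂ h₂a≡nothing)

∗-disjoint : ∀ {h h₁ h₂ a} → h ≔ h₁ ∗ h₂ → a ∈dom h₁ → ¬ a ∈dom h₂
∗-disjoint {a = a} sep a∈h₁ a∈h₂ with sep a
... | inj₁ (h₁a≡nothing , _) = a∈h₁ h₁a≡nothing
... | inj₂ (h₂a≡nothing , _) = a∈h₂ h₂a≡nothing

∅ : Heap
∅ _ = nothing

_∪_ : Heap → Heap → Heap
(h₁ ∪ h₂) a = h₁ a <∣> h₂ a

∪-∗ : ∀ {h₁ h₂} → (∀ a → h₁ a ≡ nothing ⊎ h₂ a ≡ nothing) → (h₁ ∪ h₂) ≔ h₁ ∗ h₂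
∪-∗ {h₁} disjoint a with disjoint a
... | inj₁ h₁a≡nothing rewrite h₁a≡nothing = inj₁ (refl , refl)
... | inj₂ h₂a≡nothing rewrite h₂a≡nothing = inj₂ (refl , <∣>-identityʳ (h₁ a))

Allocates : Stack → Spatial → ℤ → Set
Allocates s emp        a = ⊥
Allocates s (next x y) a = a ≡ eval s x
Allocates s (lseg x y) a = a ≡ eval s x × eval s x ≢ eval s y

AllocatedBy : Stack → SpatialConj → ℤ → Set
AllocatedBy s Σ' a = Any (λ S → Allocates s S a) Σ'

collide⇒shared : ∀ s S S' → ⟦ Collide S S' ⟧ s → ∃[ a ] Allocates s S a × Allocates s S' a
collide⇒shared s emp        S'           ()
collide⇒shared s (next x y) emp          ()
collide⇒shared s (lseg x y) emp          ()
collide⇒shared s (next x y) (next x' y') (_  , _   , x≡x') = eval s x , refl , x≡x'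
collide⇒shared s (next x y) (lseg x' y') (_  , x'≢y' , x≡x') = eval s x , refl , x≡x' , x'≢y'
collide⇒shared s (lseg x y) (next x' y') (x≢y , _  , x≡x') = eval s x , (refl , x≢y) , x≡x'
collide⇒shared s (lseg x y) (lseg x' y') (x≢y , x'≢y' , x≡x') = eval s x , (refl , x≢y) , x≡x' , x'≢y'

shared⇒collide : ∀ s S S' {a} → Allocates s S a → Allocates s S' a → ⟦ Collide S S' ⟧ s
shared⇒collide s emp        S'           ()
shared⇒collide s (next x y) emp          _ ()
shared⇒collide s (lseg x y) emp          _ ()
shared⇒collide s (next x y) (next x' y') a≡x        a≡x'          = (λ ()) , (λ ()) , trans (sym a≡x) a≡x'
shared⇒collide s (next x y) (lseg x' y') a≡x        (a≡x' , x'≢y') = (λ ()) , x'≢y' , trans (sym a≡x) a≡x'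
shared⇒collide s (lseg x y) (next x' y') (a≡x , x≢y) a≡x'          = x≢y , (λ ()) , trans (sym a≡x) a≡x'
shared⇒collide s (lseg x y) (lseg x' y') (a≡x , x≢y) (a≡x' , x'≢y') = x≢y , x'≢y' , trans (sym a≡x) a≡x'

disjoint⇒noCollideWith : ∀ s S Σ' → (∀ {a} → Allocates s S a → ¬ AllocatedBy s Σ' a) →
                          ⟦ NoCollideWith S Σ' ⟧ s
disjoint⇒noCollideWith s S []        disjoint = tt
disjoint⇒noCollideWith s S (S' ∷ Σ') disjoint =
  (λ collision → let (a , a∈S , a∈S') = collide⇒shared s S S' collision in disjoint a∈S (here a∈S')) ,
  disjoint⇒noCollideWith s S Σ' (λ a∈S a∈Σ' → disjoint a∈S (there a∈Σ'))

noCollideWith⇒disjoint : ∀ s S Σ' {a} → ⟦ NoCollideWith S Σ' ⟧ s →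
                          Allocates s S a → ¬ AllocatedBy s Σ' a
noCollideWith⇒disjoint s S (S' ∷ Σ') (¬collide , _)    a∈S (here a∈S')  = ¬collide (shared⇒collide s S S' a∈S a∈S')
noCollideWith⇒disjoint s S (S' ∷ Σ') (_ , noCollision) a∈S (there a∈Σ') = noCollideWith⇒disjoint s S Σ' noCollision a∈S a∈Σ'

⊨ₛ-allocates : ∀ {s h} S {a} → s , h ⊨ₛ S → Allocates s S a → a ∈dom h
⊨ₛ-allocates emp        _ ()
⊨ₛ-allocates (next x y) {a} h↦ a≡x = ≡just⇒≢nothing (proj₁ (h↦ a) a≡x)
⊨ₛ-allocates (lseg x y) (lseg-nil x≡y _) (_ , x≢y) = ⊥-elim (x≢y x≡y)
⊨ₛ-allocates (lseg x y) {a} (lseg-cons _ _ _ _ sep h₁↦ _) (a≡x , _) =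
  ∈dom-∗ˡ sep (≡just⇒≢nothing (proj₁ (h₁↦ a) a≡x))

⊨-allocates : ∀ {s h} Σ' {a} → s , h ⊨ Σ' → AllocatedBy s Σ' a → a ∈dom h
⊨-allocates (S ∷ Σ') (_ , _ , sep , h₁⊨S , _)  (here a∈S)   = ∈dom-∗ˡ sep (⊨ₛ-allocates S h₁⊨S a∈S)
⊨-allocates (S ∷ Σ') (_ , _ , sep , _ , h₂⊨Σ') (there a∈Σ') = ∈dom-∗ʳ sep (⊨-allocates Σ' h₂⊨Σ' a∈Σ')

⊨⇒wellFormed : ∀ {s h} Σ' → s , h ⊨ Σ' → ⟦ WellFormed Σ' ⟧ s
⊨⇒wellFormed []       _ = tt
⊨⇒wellFormed {s} (S ∷ Σ') (_ , _ , sep , h₁⊨S , h₂⊨Σ') =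
  disjoint⇒noCollideWith s S Σ'
    (λ a∈S a∈Σ' → ∗-disjoint sep (⊨ₛ-allocates S h₁⊨S a∈S) (⊨-allocates Σ' h₂⊨Σ' a∈Σ')) ,
  ⊨⇒wellFormed Σ' h₂⊨Σ'

_↦_ : ℤ → ℤ → Heap
(a ↦ b) c with c ≟ a
... | yes _ = just (IntS , b)
... | no  _ = nothing

↦-pointsTo : ∀ a b → PointsTo (a ↦ b) a b
↦-pointsTo a b c with c ≟ a
... | yes c≡a = (λ _ → refl) , (λ c≢a → ⊥-elim (c≢a c≡a))
... | no  c≢a = (λ c≡a → ⊥-elim (c≢a c≡a)) , (λ _ → refl)

↦-supported : ∀ a b c → (a ↦ b) c ≡ nothing ⊎ c ≡ a
↦-supported a b c with c ≟ a
... | yes c≡a = inj₂ c≡a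
... | no  _   = inj₁ refl

segment : ℤ → ℤ → Heap
segment u v with u ≟ v
... | yes _ = ∅
... | no  _ = u ↦ v

segment-lseg : ∀ u v → LsegSem (segment u v) u v
segment-lseg u v with u ≟ v
... | yes u≡v = lseg-nil u≡v (λ _ → refl)
... | no  u≢v = lseg-cons v (u ↦ v) ∅ u≢v (λ _ → inj₂ (refl , refl))
                  (↦-pointsTo u v) (lseg-nil refl (λ _ → refl))

segment-supported : ∀ u v c → segment u v c ≡ nothing ⊎ (c ≡ u × u ≢ v)
segment-supported u v c with u ≟ v
... | yes _ = inj₁ refl
... | no u≢v with ↦-supported u v c
...   | inj₁ c∉dom = inj₁ c∉dom
...   | inj₂ c≡u   = inj₂ (c≡u , u≢v)

minimalModelₛ : Stack → Spatial → Heap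
minimalModelₛ s emp        = ∅
minimalModelₛ s (next x y) = eval s x ↦ eval s y
minimalModelₛ s (lseg x y) = segment (eval s x) (eval s y)

minimalModelₛ-⊨ₛ : ∀ s S → s , minimalModelₛ s S ⊨ₛ S
minimalModelₛ-⊨ₛ s emp        = λ _ → refl
minimalModelₛ-⊨ₛ s (next x y) = ↦-pointsTo (eval s x) (eval s y)
minimalModelₛ-⊨ₛ s (lseg x y) = segment-lseg (eval s x) (eval s y)

minimalModelₛ-supported : ∀ s S a → minimalModelₛ s S a ≡ nothing ⊎ Allocates s S a
minimalModelₛ-supported s emp        a = inj₁ refl
minimalModelₛ-supported s (next x y) a = ↦-supported (eval s x) (eval s y) a
minimalModelₛ-supported s (lseg x y) a = segment-supported (eval s x) (eval s y) a

minimalModel : Stack → SpatialConj → Heap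
minimalModel s []       = ∅
minimalModel s (S ∷ Σ') = minimalModelₛ s S ∪ minimalModel s Σ'

minimalModel-supported : ∀ s Σ' a → minimalModel s Σ' a ≡ nothing ⊎ AllocatedBy s Σ' a
minimalModel-supported s []       a = inj₁ refl
minimalModel-supported s (S ∷ Σ') a with minimalModelₛ-supported s S a | minimalModel-supported s Σ' a
... | inj₂ a∈S         | _                = inj₂ (here a∈S)
... | inj₁ _           | inj₂ a∈Σ'        = inj₂ (there a∈Σ')
... | inj₁ a∉dom-head  | inj₁ a∉dom-tail rewrite a∉dom-head = inj₁ a∉dom-tail

wellFormed⇒minimalModel-⊨ : ∀ s Σ' → ⟦ WellFormed Σ' ⟧ s → s , minimalModel s Σ' ⊨ Σ'
wellFormed⇒minimalModel-⊨ s []       _ = λ _ → refl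
wellFormed⇒minimalModel-⊨ s (S ∷ Σ') (noCollision , wf) =
  minimalModelₛ s S , minimalModel s Σ' , ∪-∗ disjoint ,
  minimalModelₛ-⊨ₛ s S , wellFormed⇒minimalModel-⊨ s Σ' wf
  where
  disjoint : ∀ a → minimalModelₛ s S a ≡ nothing ⊎ minimalModel s Σ' a ≡ nothing
  disjoint a with minimalModelₛ-supported s S a | minimalModel-supported s Σ' a
  ... | inj₁ a∉dom-head | _               = inj₁ a∉dom-head
  ... | _               | inj₁ a∉dom-tail = inj₂ a∉dom-tail
  ... | inj₂ a∈S        | inj₂ a∈Σ'       = ⊥-elim (noCollideWith⇒disjoint s S Σ' noCollision a∈S a∈Σ')

theorem1 : (Σ' : SpatialConj) →
    (Satisfiable Σ' → PureSatisfiable (WellFormed Σ')) × (PureSatisfiable (WellFormed Σ') → Satisfiable Σ')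
theorem1 Σ' =
  (λ { (s , h , h⊨Σ') → s , ⊨⇒wellFormed Σ' h⊨Σ' }) ,
  (λ { (s , wf) → s , minimalModel s Σ' , wellFormed⇒minimalModel-⊨ s Σ' wf })
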